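{- Let $\Lambda$ be a partially ordered set. If $U$ and $V$ are upper sets of $\Lambda^{*}$ that both obey the cancellation, reduction, permutation and meet rules, then the concatenation $UV=\{uv:u\in U,v\in V\}$ also obeys these four rules.
   Context: $\Lambda^{*}$ is the set of finite words over $\Lambda$ including the empty word, with concatenation, ordered by: $\alpha_1\cdots\alpha_m\le\beta_1\cdots\beta_n$ iff there are $1\le i_1<\dots<i_m\le n$ with $\alpha_j\le\beta_{i_j}$ for all $j$. An upper set is a subset $Z$ with $z\in Z, z\le y\Rightarrow y\in Z$. Two letters are compatible if they have a common lower bound, incompatible otherwise. For words $y,z$ and a set $Z$, the rules are: (cancellation) $y\alpha z, y\beta z\in Z$ with $\alpha,\beta$ incompatible implies $yz\in Z$; (reduction) $y\alpha\alpha z, y\gamma z\in Z$ with $\alpha<\gamma$ implies $y\alpha z\in Z$; (permutation) $y\alpha\beta z, y\gamma z\in Z$ with $\alpha,\beta$ incomparable and $\alpha,\beta<\gamma$ implies $y\beta\alpha z\in Z$; (meet) $y\alpha z, y\beta z\in Z$ with $\alpha,\beta$ incomparable having a meet $\alpha\wedge\beta$ in $\Lambda$ implies $y(\alpha\wedge\beta)z\in Z$. -}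

module Defs where

open import Level using (Level; _⊔_; suc)
open import Data.List using (List; []; _∷_; _++_)
open import Data.Product using (Σ; _×_; ∃; ∃-syntax; _,_)
open import Relation.Nullary using (¬_)
open import Relation.Binary.PropositionalEquality using (_≡_)
open import Relation.Binary.Bundles using (Poset)
import Data.List.Relation.Binary.Sublist.Heterogeneous.Core as SubCore

module Words {c ℓ₁ ℓ₂ : Level} (Λ : Poset c ℓ₁ ℓ₂) where
  open Poset Λ renaming (Carrier to L)

  Word : Set c
  Word = List L

  WSet : (ℓ : Level) → Set (c ⊔ suc ℓ)
  WSet ℓ = Word → Set ℓ

  -- word order: α₁⋯αₘ ≤ β₁⋯βₙ iff there are i₁<⋯<iₘ with αⱼ ≤ β_{iⱼ}
  _≤w_ : Word → Word → Set (c ⊔ ℓ₂)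
  _≤w_ = SubCore.Sublist _≤_

  _<_ : L → L → Set (ℓ₁ ⊔ ℓ₂)
  a < b = a ≤ b × ¬ (a ≈ b)

  Compatible : L → L → Set (c ⊔ ℓ₂)
  Compatible a b = ∃[ d ] (d ≤ a × d ≤ b)

  Incompatible : L → L → Set (c ⊔ ℓ₂)
  Incompatible a b = ¬ Compatible a b

  Incomparable : L → L → Set ℓ₂
  Incomparable a b = ¬ (a ≤ b) × ¬ (b ≤ a)

  IsMeet : L → L → L → Set (c ⊔ ℓ₂)
  IsMeet a b m = m ≤ a × m ≤ b × (∀ d → d ≤ a → d ≤ b → d ≤ m)

  module _ {ℓ : Level} (Z : WSet ℓ) where

    IsUpperSet : Set (c ⊔ ℓ ⊔ ℓ₂)
    IsUpperSet = ∀ z y → Z z → z ≤w y → Z y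

    CancellationRule : Set (c ⊔ ℓ ⊔ ℓ₂)
    CancellationRule = ∀ y z α β →
      Z (y ++ α ∷ z) → Z (y ++ β ∷ z) → Incompatible α β → Z (y ++ z)

    ReductionRule : Set (c ⊔ ℓ ⊔ ℓ₁ ⊔ ℓ₂)
    ReductionRule = ∀ y z α γ →
      Z (y ++ α ∷ α ∷ z) → Z (y ++ γ ∷ z) → α < γ → Z (y ++ α ∷ z)

    PermutationRule : Set (c ⊔ ℓ ⊔ ℓ₁ ⊔ ℓ₂)
    PermutationRule = ∀ y z α β γ →
      Z (y ++ α ∷ β ∷ z) → Z (y ++ γ ∷ z) → Incomparable α β →
      α < γ → β < γ → Z (y ++ β ∷ α ∷ z)

    MeetRule : Set (c ⊔ ℓ ⊔ ℓ₂)
    MeetRule = ∀ y z α β m →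
      Z (y ++ α ∷ z) → Z (y ++ β ∷ z) → Incomparable α β →
      IsMeet α β m → Z (y ++ m ∷ z)

    ObeysFourRules : Set (c ⊔ ℓ ⊔ ℓ₁ ⊔ ℓ₂)
    ObeysFourRules = CancellationRule × ReductionRule × PermutationRule × MeetRule

  _·_ : {ℓ ℓ' : Level} → WSet ℓ → WSet ℓ' → WSet (c ⊔ ℓ ⊔ ℓ')
  (U · V) w = ∃[ u ] ∃[ v ] (U u × V v × w ≡ u ++ v)

module Submission where

-- Each of the four rules has the shape "if y I z and y J z lie in Z then
-- so does y O z" for fixed words I, J, O, where J = γ is a single letter
-- and I is a single letter (cancellation, meet) or a two-letter word
-- (reduction, permutation).  We prove once and for all that such a rule
-- passes from upper sets U and V to UV, provided each proper prefix and
-- proper suffix of I lies below O.  Write y I z = u v and y γ z = u' v'.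
-- By Levi's lemma for lists, the occurrence of I lies inside u, inside v,
-- or across the cut; γ lies inside u' or inside v'.  If both occurrences
-- are on the same side, the shorter of the two U-parts (or V-parts) is
-- padded, using upward closure, until the rule of U (or V) applies.  If
-- they are on opposite sides, y O z splits into a word above u' (or u)
-- and one of V.  If I lies across the cut, the piece of I in u (or v) is
-- raised to O.

open import Defs
open import Level using (Level; _⊔_)
open import Data.Product using (_×_; _,_; proj₁; proj₂; ∃-syntax)
open import Data.Sum using (_⊎_; inj₁; inj₂)
open import Data.List using (List; []; _∷_; _++_)
open import Data.List.Properties using (∷-injective; ++-assoc; ++-identityʳ)
open import Relation.Nullary using (¬_)
open import Data.Empty using (⊥-elim)
open import Relation.Binary.PropositionalEquality
  using (_≡_; refl; sym; trans; cong; subst)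
open import Relation.Binary.Bundles using (Poset)
open import Data.List.Relation.Binary.Sublist.Heterogeneous.Core using ([]; _∷_; _∷ʳ_)
open import Data.List.Relation.Binary.Sublist.Heterogeneous.Properties
  using (++⁺; ++ˡ; ++ʳ; poset)

module _ {a} {A : Set a} where

  ++-levi : (p q r s : List A) → p ++ q ≡ r ++ s →
    (∃[ t ] r ≡ p ++ t × q ≡ t ++ s) ⊎ (∃[ t ] p ≡ r ++ t × s ≡ t ++ q)
  ++-levi []      q r       s eq = inj₁ (r , refl , eq)
  ++-levi (x ∷ p) q []      s eq = inj₂ (x ∷ p , refl , sym eq)
  ++-levi (x ∷ p) q (y ∷ r) s eq with ∷-injective eq
  ... | refl , tail≡ with ++-levi p q r s tail≡
  ...   | inj₁ (t , refl , q≡) = inj₁ (t , refl , q≡)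
  ...   | inj₂ (t , refl , s≡) = inj₂ (t , refl , s≡)

  data Position (y I z u v : List A) : Set a where
    inLeft  : ∀ z₁ → u ≡ y ++ I ++ z₁ → z ≡ z₁ ++ v → Position y I z u v
    inRight : ∀ y₂ → y ≡ u ++ y₂ → v ≡ y₂ ++ I ++ z → Position y I z u v
    across  : ∀ b I₁ c I₂ → I ≡ (b ∷ I₁) ++ (c ∷ I₂) →
              u ≡ y ++ b ∷ I₁ → v ≡ c ∷ I₂ ++ z → Position y I z u v

  cutAt : ∀ y t s z → Position y (t ++ s) z (y ++ t) (s ++ z)
  cutAt y []      s       z = inRight [] (sym (trans (++-identityʳ (y ++ [])) (++-identityʳ y))) refl
  cutAt y (b ∷ t) []      z = inLeft [] (cong (y ++_) (sym pad)) refl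
    where
    pad : ((b ∷ t) ++ []) ++ [] ≡ b ∷ t
    pad = trans (++-identityʳ _) (++-identityʳ (b ∷ t))
  cutAt y (b ∷ t) (c ∷ s) z = across b t c s refl refl refl

  locate : ∀ y I z u v → y ++ I ++ z ≡ u ++ v → Position y I z u v
  locate y I z u v eq with ++-levi y (I ++ z) u v eq
  ... | inj₂ (y₂ , y≡ , v≡) = inRight y₂ y≡ v≡
  ... | inj₁ (t , refl , rest) with ++-levi I z t v rest
  ...   | inj₁ (z₁ , refl , z≡)  = inLeft z₁ refl z≡
  ...   | inj₂ (s , refl , refl) = cutAt y t s z

  letter-unsplittable : ∀ {γ b c : A} I₁ I₂ → ¬ (γ ∷ [] ≡ (b ∷ I₁) ++ (c ∷ I₂))
  letter-unsplittable []      _ ()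
  letter-unsplittable (_ ∷ _) _ ()

  regroup : (y O w v : List A) → y ++ O ++ w ++ v ≡ (y ++ O ++ w) ++ v
  regroup y O w v = sym (trans (++-assoc y (O ++ w) v) (cong (y ++_) (++-assoc O w v)))

module Concatenation {c ℓ₁ ℓ₂ : Level} (Λ : Poset c ℓ₁ ℓ₂) where
  open Words Λ
  open Poset (poset Λ) using () renaming (refl to ≤w-refl)

  module _ {ℓ : Level} {Z : WSet ℓ} (up : IsUpperSet Z) where

    raiseʳ : ∀ {y p q} → p ≤w q → Z (y ++ p) → Z (y ++ q)
    raiseʳ {y} p≤q Zyp = up _ _ Zyp (++⁺ (≤w-refl {y}) p≤q)

    raiseˡ : ∀ {p q z} → p ≤w q → Z (p ++ z) → Z (q ++ z)
    raiseˡ {z = z} p≤q Zpz = up _ _ Zpz (++⁺ p≤q (≤w-refl {z}))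

    padʳ : ∀ {w} t → Z w → Z (w ++ t)
    padʳ t Zw = up _ _ Zw (++ʳ t ≤w-refl)

    padˡ : ∀ {w} t → Z w → Z (t ++ w)
    padˡ t Zw = up _ _ Zw (++ˡ t ≤w-refl)

    padPrefix : ∀ {p w} t → Z (p ++ w) → Z ((t ++ p) ++ w)
    padPrefix {p} {w} t Zpw = subst Z (sym (++-assoc t p w)) (padˡ t Zpw)

    padInner : ∀ y I {w} t → Z (y ++ I ++ w) → Z (y ++ I ++ w ++ t)
    padInner y I t = raiseʳ {y} (++⁺ (≤w-refl {I}) (++ʳ t ≤w-refl))

  ClosedUnder : {ℓ : Level} → WSet ℓ → Word → Word → Word → Set (c ⊔ ℓ)
  ClosedUnder Z I J O = ∀ y z → Z (y ++ I ++ z) → Z (y ++ J ++ z) → Z (y ++ O ++ z)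

  PiecesBelow : Word → Word → Set (c ⊔ ℓ₂)
  PiecesBelow I O = ∀ b I₁ c I₂ → I ≡ (b ∷ I₁) ++ (c ∷ I₂) →
                    (b ∷ I₁) ≤w O × (c ∷ I₂) ≤w O

  letter-piecesBelow : ∀ {α O} → PiecesBelow (α ∷ []) O
  letter-piecesBelow _ I₁ _ I₂ eq = ⊥-elim (letter-unsplittable I₁ I₂ eq)

  pair-piecesBelow : ∀ {α β O} → (α ∷ []) ≤w O → (β ∷ []) ≤w O →
                     PiecesBelow (α ∷ β ∷ []) O
  pair-piecesBelow α≤O β≤O _ []          _ []      refl = α≤O , β≤O
  pair-piecesBelow _   _   _ []          _ (_ ∷ _) ()
  pair-piecesBelow _   _   _ (_ ∷ [])    _ _       ()
  pair-piecesBelow _   _   _ (_ ∷ _ ∷ _) _ _       ()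

  module _ {ℓ : Level} {U V : WSet ℓ} (upU : IsUpperSet U) (upV : IsUpperSet V) where

    -- Both occurrences inside the U-part: pad the shorter U-part on the
    -- right so that the rule of U applies, and keep the shorter V-part.
    bothLeft : ∀ {y I J O z₁ z₁' v v'} → ClosedUnder U I J O →
      U (y ++ I ++ z₁) → V v → U (y ++ J ++ z₁') → V v' → z₁ ++ v ≡ z₁' ++ v' →
      (U · V) (y ++ O ++ z₁ ++ v)
    bothLeft {y} {I} {J} {O} {z₁} {z₁'} {v} {v'} R UIz Vv UJz Vv' eq
      with ++-levi z₁ v z₁' v' eq
    ... | inj₁ (t , refl , refl) =
      y ++ O ++ z₁ ++ t , v' , R y (z₁ ++ t) (padInner upU y I t UIz) UJz , Vv' ,
      trans (cong (λ w → y ++ O ++ w) (sym (++-assoc z₁ t v'))) (regroup y O (z₁ ++ t) v')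
    ... | inj₂ (t , refl , refl) =
      y ++ O ++ z₁' ++ t , v , R y (z₁' ++ t) UIz (padInner upU y J t UJz) , Vv ,
      regroup y O (z₁' ++ t) v

    bothRight : ∀ {z I J O y₂ y₂' u u'} → ClosedUnder V I J O →
      U u → V (y₂ ++ I ++ z) → U u' → V (y₂' ++ J ++ z) → u ++ y₂ ≡ u' ++ y₂' →
      (U · V) ((u ++ y₂) ++ O ++ z)
    bothRight {z = z} {O = O} {y₂ = y₂} {y₂' = y₂'} {u = u} {u' = u'} R Uu VIz Uu' VJz eq
      with ++-levi u y₂ u' y₂' eq
    ... | inj₁ (t , refl , refl) =
      u , (t ++ y₂') ++ O ++ z , Uu , R (t ++ y₂') z VIz (padPrefix upV t VJz) ,
      ++-assoc u (t ++ y₂') (O ++ z)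
    ... | inj₂ (t , refl , refl) =
      u' , (t ++ y₂) ++ O ++ z , Uu' , R (t ++ y₂) z (padPrefix upV t VIz) VJz ,
      trans (cong (_++ O ++ z) (++-assoc u' t y₂)) (++-assoc u' (t ++ y₂) (O ++ z))

    -- Occurrences on opposite sides: whatever O is, u' y₂ O z₁ lies above
    -- u' ∈ U and is followed by v ∈ V.
    separated : ∀ {u' y₂ O z₁ v} → U u' → V v → (U · V) ((u' ++ y₂) ++ O ++ z₁ ++ v)
    separated {u'} {y₂} {O} {z₁} {v} Uu' Vv =
      u' ++ y₂ ++ O ++ z₁ , v , padʳ upU (y₂ ++ O ++ z₁) Uu' , Vv ,
      trans (++-assoc u' y₂ (O ++ z₁ ++ v))
            (trans (cong (u' ++_) (regroup y₂ O z₁ v)) (sym (++-assoc u' (y₂ ++ O ++ z₁) v)))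

    concat-closed : ∀ {I γ O} → PiecesBelow I O →
      ClosedUnder U I (γ ∷ []) O → ClosedUnder V I (γ ∷ []) O →
      ClosedUnder (U · V) I (γ ∷ []) O
    concat-closed {I} {γ} {O} pieces RU RV y z (u , v , Uu , Vv , e) (u' , v' , Uu' , Vv' , e')
      with locate y I z u v e | locate y (γ ∷ []) z u' v' e'
    ... | _ | across _ I₁ _ I₂ split _ _ = ⊥-elim (letter-unsplittable I₁ I₂ split)
    ... | inLeft _ refl refl   | inLeft _ refl eq'  = bothLeft RU Uu Vv Uu' Vv' eq'
    ... | inLeft z₁ refl refl  | inRight _ refl refl = separated {O = O} {z₁ = z₁} Uu' Vv
    ... | inRight _ refl refl  | inLeft z₁' refl refl = separated {O = O} {z₁ = z₁'} Uu Vv'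
    ... | inRight _ refl refl  | inRight _ eq' refl = bothRight RV Uu Vv Uu' Vv' eq'
    ... | across b I₁ c I₂ split refl refl | inLeft z₁' refl refl =
      y ++ O , z₁' ++ v' , raiseʳ upU (proj₁ (pieces b I₁ c I₂ split)) Uu ,
      padˡ upV z₁' Vv' , sym (++-assoc y O (z₁' ++ v'))
    ... | across b I₁ c I₂ split refl refl | inRight y₂' refl refl =
      u' ++ y₂' , O ++ z , padʳ upU y₂' Uu' ,
      raiseˡ upV (proj₂ (pieces b I₁ c I₂ split)) Vv , refl

lemma4p3 : {c ℓ₁ ℓ₂ ℓ : Level} (Λ : Poset c ℓ₁ ℓ₂) →
    let open Words Λ in
    (U V : WSet ℓ) →
    IsUpperSet U → IsUpperSet V →
    ObeysFourRules U → ObeysFourRules V →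
    ObeysFourRules (U · V)
lemma4p3 Λ U V upU upV (cancelU , reduceU , permuteU , meetU) (cancelV , reduceV , permuteV , meetV) =
  cancel , reduce , permute , meet
  where
  open Words Λ
  open Concatenation Λ
  open Poset Λ using () renaming (refl to ≤-refl)

  cancel : CancellationRule (U · V)
  cancel y z α β yαz yβz inc = concat-closed upU upV letter-piecesBelow
    (λ y′ z′ p q → cancelU y′ z′ α β p q inc) (λ y′ z′ p q → cancelV y′ z′ α β p q inc)
    y z yαz yβz

  reduce : ReductionRule (U · V)
  reduce y z α γ yααz yγz α<γ =
    concat-closed upU upV (pair-piecesBelow (≤-refl ∷ []) (≤-refl ∷ []))
      (λ y′ z′ p q → reduceU y′ z′ α γ p q α<γ) (λ y′ z′ p q → reduceV y′ z′ α γ p q α<γ)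
      y z yααz yγz

  -- Permutation: y α β z, y γ z ⊢ y β α z; α and β are both below β α.
  permute : PermutationRule (U · V)
  permute y z α β γ yαβz yγz inc α<γ β<γ =
    concat-closed upU upV (pair-piecesBelow (β ∷ʳ (≤-refl ∷ [])) (≤-refl ∷ (α ∷ʳ [])))
      (λ y′ z′ p q → permuteU y′ z′ α β γ p q inc α<γ β<γ)
      (λ y′ z′ p q → permuteV y′ z′ α β γ p q inc α<γ β<γ)
      y z yαβz yγz

  meet : MeetRule (U · V)
  meet y z α β m yαz yβz inc isMeet = concat-closed upU upV letter-piecesBelow
    (λ y′ z′ p q → meetU y′ z′ α β m p q inc isMeet)
    (λ y′ z′ p q → meetV y′ z′ α β m p q inc isMeet)
    y z yαz yβz
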